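{- If $a_3\geq 3$ and $a_3\equiv 1\bmod 2$, then the triple $(3,6,a_3)$ is perfect.
   Context: For a graph $G$, the $3$-neighbour bootstrap process starts from a set $A_0\subseteq V(G)$ and, for $t\ge1$, sets $A_t=A_{t-1}\cup\{v: |N_G(v)\cap A_{t-1}|\ge 3\}$; $A_0$ percolates if $\bigcup_t A_t=V(G)$. For positive integers $a_1,a_2,a_3$, $[a_1]\times[a_2]\times[a_3]$ denotes the grid graph (vertices adjacent iff they differ by exactly 1 in exactly one coordinate), and $m(a_1,a_2,a_3;3)$ is the minimum size of a percolating set for the $3$-neighbour process in it. A triple $(a_1,a_2,a_3)$ of positive integers is called perfect if $a_1a_2+a_1a_3+a_2a_3\equiv 0\pmod 3$ and $m(a_1,a_2,a_3;3)=\frac{a_1a_2+a_1a_3+a_2a_3}{3}$. -}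

module Defs where

open import Data.Nat using (ℕ; zero; suc; _+_; _*_; _≤_; _≡ᵇ_; _≤ᵇ_)
open import Data.Nat.DivMod using (_/_; _%_)
open import Data.Bool using (Bool; true; false; _∧_; _∨_)
open import Data.Fin using (Fin; toℕ)
open import Data.List using (List; length; filter; allFin; cartesianProduct; map)
open import Data.Product using (_×_; _,_; ∃; ∃-syntax; Σ-syntax)
open import Relation.Binary.PropositionalEquality using (_≡_)
open import Relation.Nullary.Decidable using (does)
open import Data.Bool.Properties using (T?)
open import Data.Bool using (T)

Vertex : ℕ → ℕ → ℕ → Set
Vertex a₁ a₂ a₃ = Fin a₁ × Fin a₂ × Fin a₃

vertices : (a₁ a₂ a₃ : ℕ) → List (Vertex a₁ a₂ a₃)
vertices a₁ a₂ a₃ = cartesianProduct (allFin a₁) (cartesianProduct (allFin a₂) (allFin a₃))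

diff1 : ℕ → ℕ → Bool
diff1 i j = (suc i ≡ᵇ j) ∨ (suc j ≡ᵇ i)

eqℕ : ℕ → ℕ → Bool
eqℕ i j = i ≡ᵇ j

adj : ∀ {a₁ a₂ a₃} → Vertex a₁ a₂ a₃ → Vertex a₁ a₂ a₃ → Bool
adj (x₁ , x₂ , x₃) (y₁ , y₂ , y₃) =
     (diff1 (toℕ x₁) (toℕ y₁) ∧ eqℕ (toℕ x₂) (toℕ y₂) ∧ eqℕ (toℕ x₃) (toℕ y₃))
  ∨ (eqℕ (toℕ x₁) (toℕ y₁) ∧ diff1 (toℕ x₂) (toℕ y₂) ∧ eqℕ (toℕ x₃) (toℕ y₃))
  ∨ (eqℕ (toℕ x₁) (toℕ y₁) ∧ eqℕ (toℕ x₂) (toℕ y₂) ∧ diff1 (toℕ x₃) (toℕ y₃))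

VSet : ℕ → ℕ → ℕ → Set
VSet a₁ a₂ a₃ = Vertex a₁ a₂ a₃ → Bool

size : ∀ {a₁ a₂ a₃} → VSet a₁ a₂ a₃ → ℕ
size {a₁} {a₂} {a₃} A = length (filter (λ v → T? (A v)) (vertices a₁ a₂ a₃))

nbrCount : ∀ {a₁ a₂ a₃} → VSet a₁ a₂ a₃ → Vertex a₁ a₂ a₃ → ℕ
nbrCount {a₁} {a₂} {a₃} A v =
  length (filter (λ w → T? (adj v w ∧ A w)) (vertices a₁ a₂ a₃))

step : ∀ {a₁ a₂ a₃} → ℕ → VSet a₁ a₂ a₃ → VSet a₁ a₂ a₃
step r A v = A v ∨ (r ≤ᵇ nbrCount A v)

iter : ∀ {a₁ a₂ a₃} → ℕ → VSet a₁ a₂ a₃ → ℕ → VSet a₁ a₂ a₃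
iter r A zero    = A
iter r A (suc t) = step r (iter r A t)

Percolates : ∀ {a₁ a₂ a₃} → ℕ → VSet a₁ a₂ a₃ → Set
Percolates {a₁} {a₂} {a₃} r A = (v : Vertex a₁ a₂ a₃) → ∃[ t ] (iter r A t v ≡ true)

IsMinPercSize : ℕ → ℕ → ℕ → ℕ → ℕ → Set
IsMinPercSize a₁ a₂ a₃ r k =
    (∃[ A ] (Percolates {a₁} {a₂} {a₃} r A × size A ≡ k))
  × ((A : VSet a₁ a₂ a₃) → Percolates r A → k ≤ size A)

σ₂ : ℕ → ℕ → ℕ → ℕ
σ₂ a₁ a₂ a₃ = a₁ * a₂ + a₁ * a₃ + a₂ * a₃

Perfect : ℕ → ℕ → ℕ → Set
Perfect a₁ a₂ a₃ = (σ₂ a₁ a₂ a₃ % 3 ≡ 0) × IsMinPercSize a₁ a₂ a₃ 3 (σ₂ a₁ a₂ a₃ / 3)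

-- When a vertex becomes infected it has at least three infected neighbours, so the
-- quantity 6|A_t| - 2e(A_t), with e(A_t) the number of grid edges inside A_t, never increases.  Comparing
-- A_0 with the fully infected grid gives 6|V| ≤ 6|A_0| + 2|E|, which for [3] × [6] × [a] reads
-- 108a ≤ 6|A_0| + 90a - 36, that is |A_0| ≥ 3a + 6 = σ₂/3.
--
-- Stack explicit layers of 3 × 6 cells: 5 seeds in the bottom layer, 3 in each interior
-- layer, alternating between two patterns (this is where a odd is needed), and 5 in each of the top two
-- layers, 3a + 6 seeds in all.  Every vertex gets a rank, affine in its height above the bottom and below
-- the top, such that each non-seed has three neighbours that are seeds or of smaller rank; by induction
-- on the rank everything gets infected.  A layer only sees its two neighbouring layers, so this is a
-- finite list of local windows, each checked by evaluation.

module Submission where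

open import Defs
open import Data.Bool using (Bool; true; false; _∧_; _∨_; not; T)
open import Data.Bool.ListAction using (all)
open import Data.Bool.Properties using (T?; T-≡; ∨-comm; ∨-zeroʳ; ∧-zeroʳ)
open import Data.Empty using (⊥-elim)
open import Data.Fin using (Fin; toℕ; fromℕ<; inject₁) renaming (zero to fzero; suc to fsuc)
open import Data.Fin.Properties using (toℕ<n; toℕ-fromℕ<; toℕ-inject₁) renaming (_≟_ to _≟ᶠ_)
open import Data.Integer as ℤ using (ℤ; -[1+_]; _⊖_)
open import Data.Integer.Properties using (n⊖n≡0; ⊖-swap; [1+m]⊖[1+n]≡m⊖n)
open import Data.List using (List; []; _∷_; _++_; length; filter; map; cartesianProduct; allFin)
open import Data.List.Membership.Propositional using (_∈_)
open import Data.List.Membership.Propositional.Properties using (∈-cartesianProduct⁺; ∈-allFin)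
open import Data.List.Properties using (length-++; length-map; length-tabulate; map-tabulate)
open import Data.List.Relation.Unary.All as All using (All; []; _∷_)
open import Data.List.Relation.Unary.All.Properties using (all⁺; all-filter)
open import Data.List.Relation.Unary.AllPairs using ([]; _∷_)
open import Data.List.Relation.Unary.Any using (here; there)
open import Data.List.Relation.Unary.Unique.Propositional using (Unique)
open import Data.List.Relation.Unary.Unique.Propositional.Properties using (filter⁺)
open import Data.Maybe using (Maybe; just; nothing)
open import Data.Maybe.Properties using (just-injective)
open import Data.Nat
  using (ℕ; zero; suc; pred; _+_; _*_; _∸_; _≤_; _<_; _≡ᵇ_; _<ᵇ_; _≤ᵇ_; _⊔_; _<?_; z≤n; s≤s; s≤s⁻¹)
open import Data.Nat.DivMod using (_%_; _/_; m*n%n≡0; m*n/n≡m)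
open import Data.Nat.Properties
open import Data.Nat.Tactic.RingSolver using (solve-∀)
open import Data.Product using (_×_; _,_; ∃-syntax)
open import Data.Product.Properties using (≡-dec)
open import Data.Sum using (_⊎_; inj₁; inj₂)
open import Data.Unit using (⊤; tt)
open import Data.Vec using (Vec; []; _∷_; lookup)
open import Function.Bundles using (Equivalence)
open import Relation.Binary.Definitions using (DecidableEquality)
open import Relation.Binary.PropositionalEquality
open import Relation.Nullary using (yes; no; does)
open import Relation.Unary using (Decidable)

ind : Bool → ℕ
ind true  = 1
ind false = 0

ind-∧ : ∀ b c → ind (b ∧ c) ≡ ind b * ind c
ind-∧ true  c = sym (+-identityʳ (ind c))
ind-∧ false c = refl

ind-∨₃ : ∀ b c d → (b ∧ c) ≡ false → (b ∧ d) ≡ false → (c ∧ d) ≡ false →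
         ind (b ∨ c ∨ d) ≡ ind b + ind c + ind d
ind-∨₃ false false false _  _  _  = refl
ind-∨₃ false false true  _  _  _  = refl
ind-∨₃ false true  false _  _  _  = refl
ind-∨₃ false true  true  _  _  ()
ind-∨₃ true  false false _  _  _  = refl
ind-∨₃ true  true  _     () _  _
ind-∨₃ true  false true  _  () _

module _ {A : Set} where

  sumOver : (A → ℕ) → List A → ℕ
  sumOver f []       = 0
  sumOver f (x ∷ xs) = f x + sumOver f xs

  count : (A → Bool) → List A → ℕ
  count p = sumOver (λ x → ind (p x))

  length-filter≡count : ∀ (p : A → Bool) xs → length (filter (λ x → T? (p x)) xs) ≡ count p xs
  length-filter≡count p []       = refl
  length-filter≡count p (x ∷ xs) with p x
  ... | true  = cong suc (length-filter≡count p xs)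
  ... | false = length-filter≡count p xs

  sumOver-cong : ∀ {f g : A → ℕ} → (∀ x → f x ≡ g x) → ∀ xs → sumOver f xs ≡ sumOver g xs
  sumOver-cong f≡g []       = refl
  sumOver-cong f≡g (x ∷ xs) = cong₂ _+_ (f≡g x) (sumOver-cong f≡g xs)

  sumOver-mono : ∀ {f g : A → ℕ} → (∀ x → f x ≤ g x) → ∀ xs → sumOver f xs ≤ sumOver g xs
  sumOver-mono f≤g []       = z≤n
  sumOver-mono f≤g (x ∷ xs) = +-mono-≤ (f≤g x) (sumOver-mono f≤g xs)

  sumOver-+ : ∀ (f g : A → ℕ) xs → sumOver (λ x → f x + g x) xs ≡ sumOver f xs + sumOver g xs
  sumOver-+ f g []       = refl
  sumOver-+ f g (x ∷ xs) = begin
    f x + g x + sumOver (λ x → f x + g x) xs   ≡⟨ cong (f x + g x +_) (sumOver-+ f g xs) ⟩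
    f x + g x + (sumOver f xs + sumOver g xs)  ≡⟨ +-+-exchange (f x) (g x) _ _ ⟩
    f x + sumOver f xs + (g x + sumOver g xs)  ∎
    where
    open ≡-Reasoning
    +-+-exchange : ∀ a b c d → a + b + (c + d) ≡ a + c + (b + d)
    +-+-exchange = solve-∀

  sumOver-+₃ : ∀ (f g h : A → ℕ) xs →
               sumOver (λ x → f x + g x + h x) xs ≡ sumOver f xs + sumOver g xs + sumOver h xs
  sumOver-+₃ f g h xs = trans (sumOver-+ (λ x → f x + g x) h xs) (cong (_+ sumOver h xs) (sumOver-+ f g xs))

  sumOver-*ˡ : ∀ c (f : A → ℕ) xs → sumOver (λ x → c * f x) xs ≡ c * sumOver f xs
  sumOver-*ˡ c f []       = sym (*-zeroʳ c)
  sumOver-*ˡ c f (x ∷ xs) = trans (cong (c * f x +_) (sumOver-*ˡ c f xs)) (sym (*-distribˡ-+ c (f x) _))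

  sumOver-*ʳ : ∀ c (f : A → ℕ) xs → sumOver (λ x → f x * c) xs ≡ sumOver f xs * c
  sumOver-*ʳ c f xs = begin
    sumOver (λ x → f x * c) xs  ≡⟨ sumOver-cong (λ x → *-comm (f x) c) xs ⟩
    sumOver (λ x → c * f x) xs  ≡⟨ sumOver-*ˡ c f xs ⟩
    c * sumOver f xs            ≡⟨ *-comm c _ ⟩
    sumOver f xs * c            ∎
    where open ≡-Reasoning

  sumOver-zero : ∀ (xs : List A) → sumOver (λ _ → 0) xs ≡ 0
  sumOver-zero []       = refl
  sumOver-zero (_ ∷ xs) = sumOver-zero xs

  sumOver-const : ∀ c (xs : List A) → sumOver (λ _ → c) xs ≡ c * length xs
  sumOver-const c []       = sym (*-zeroʳ c)
  sumOver-const c (x ∷ xs) = trans (cong (c +_) (sumOver-const c xs)) (sym (*-suc c (length xs)))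

  sumOver-++ : ∀ (f : A → ℕ) xs ys → sumOver f (xs ++ ys) ≡ sumOver f xs + sumOver f ys
  sumOver-++ f []       ys = refl
  sumOver-++ f (x ∷ xs) ys = trans (cong (f x +_) (sumOver-++ f xs ys)) (sym (+-assoc (f x) _ _))

sumOver-map : ∀ {A B : Set} (f : B → ℕ) (g : A → B) xs → sumOver f (map g xs) ≡ sumOver (λ x → f (g x)) xs
sumOver-map f g []       = refl
sumOver-map f g (x ∷ xs) = cong (f (g x) +_) (sumOver-map f g xs)

module _ {A B : Set} where

  sumOver-cartesianProduct : ∀ (f : A × B → ℕ) xs ys →
    sumOver f (cartesianProduct xs ys) ≡ sumOver (λ x → sumOver (λ y → f (x , y)) ys) xs
  sumOver-cartesianProduct f []       ys = refl
  sumOver-cartesianProduct f (x ∷ xs) ys = begin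
    sumOver f (map (x ,_) ys ++ cartesianProduct xs ys)
      ≡⟨ sumOver-++ f (map (x ,_) ys) _ ⟩
    sumOver f (map (x ,_) ys) + sumOver f (cartesianProduct xs ys)
      ≡⟨ cong₂ _+_ (sumOver-map f (x ,_) ys) (sumOver-cartesianProduct f xs ys) ⟩
    sumOver (λ y → f (x , y)) ys + sumOver (λ x → sumOver (λ y → f (x , y)) ys) xs ∎
    where open ≡-Reasoning

  sumOver-comm : ∀ (f : A → B → ℕ) xs ys →
    sumOver (λ x → sumOver (f x) ys) xs ≡ sumOver (λ y → sumOver (λ x → f x y) xs) ys
  sumOver-comm f []       ys = sym (sumOver-zero ys)
  sumOver-comm f (x ∷ xs) ys = begin
    sumOver (f x) ys + sumOver (λ x → sumOver (f x) ys) xs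
      ≡⟨ cong (sumOver (f x) ys +_) (sumOver-comm f xs ys) ⟩
    sumOver (f x) ys + sumOver (λ y → sumOver (λ x → f x y) xs) ys
      ≡⟨ sumOver-+ (f x) _ ys ⟨
    sumOver (λ y → f x y + sumOver (λ x → f x y) xs) ys ∎
    where open ≡-Reasoning

length-cartesianProduct : ∀ {A B : Set} (xs : List A) (ys : List B) →
                          length (cartesianProduct xs ys) ≡ length xs * length ys
length-cartesianProduct []       ys = refl
length-cartesianProduct (x ∷ xs) ys = begin
  length (map (x ,_) ys ++ cartesianProduct xs ys)
    ≡⟨ length-++ (map (x ,_) ys) ⟩
  length (map (x ,_) ys) + length (cartesianProduct xs ys)
    ≡⟨ cong₂ _+_ (length-map (x ,_) ys) (length-cartesianProduct xs ys) ⟩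
  length ys + length xs * length ys ∎
  where open ≡-Reasoning

length-allFin : ∀ n → length (allFin n) ≡ n
length-allFin n = length-tabulate (λ i → i)

sumOver-allFin-suc : ∀ n (f : Fin (suc n) → ℕ) →
                     sumOver f (allFin (suc n)) ≡ f fzero + sumOver (λ i → f (fsuc i)) (allFin n)
sumOver-allFin-suc n f =
  cong (f fzero +_) (trans (cong (sumOver f) (sym (map-tabulate (λ i → i) fsuc))) (sumOver-map f fsuc (allFin n)))

module _ {A B C : Set} where

  sumOver³ : (A → B → C → ℕ) → List A → List B → List C → ℕ
  sumOver³ f xs ys zs = sumOver (λ x → sumOver (λ y → sumOver (λ z → f x y z) zs) ys) xs

  sumOver³-cong : ∀ {f g : A → B → C → ℕ} → (∀ x y z → f x y z ≡ g x y z) → ∀ xs ys zs →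
                  sumOver³ f xs ys zs ≡ sumOver³ g xs ys zs
  sumOver³-cong f≡g xs ys zs = sumOver-cong (λ x → sumOver-cong (λ y → sumOver-cong (f≡g x y) zs) ys) xs

  sumOver³-+₃ : ∀ (f g h : A → B → C → ℕ) xs ys zs →
    sumOver³ (λ x y z → f x y z + g x y z + h x y z) xs ys zs
    ≡ sumOver³ f xs ys zs + sumOver³ g xs ys zs + sumOver³ h xs ys zs
  sumOver³-+₃ f g h xs ys zs =
    trans (sumOver-cong (λ x → trans (sumOver-cong (λ y → sumOver-+₃ (f x y) (g x y) (h x y) zs) ys)
                                     (sumOver-+₃ _ _ _ ys)) xs)
          (sumOver-+₃ _ _ _ xs)

  sumOver³-product : ∀ (f : A → ℕ) (g : B → ℕ) (h : C → ℕ) xs ys zs →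
    sumOver³ (λ x y z → f x * (g y * h z)) xs ys zs ≡ sumOver f xs * (sumOver g ys * sumOver h zs)
  sumOver³-product f g h xs ys zs = begin
    sumOver (λ x → sumOver (λ y → sumOver (λ z → f x * (g y * h z)) zs) ys) xs
      ≡⟨ sumOver-cong (λ x → sumOver-cong (λ y →
           trans (sumOver-*ˡ (f x) _ zs) (cong (f x *_) (sumOver-*ˡ (g y) h zs))) ys) xs ⟩
    sumOver (λ x → sumOver (λ y → f x * (g y * H)) ys) xs
      ≡⟨ sumOver-cong (λ x → trans (sumOver-*ˡ (f x) _ ys) (cong (f x *_) (sumOver-*ʳ H g ys))) xs ⟩
    sumOver (λ x → f x * (sumOver g ys * H)) xs
      ≡⟨ sumOver-*ʳ (sumOver g ys * H) f xs ⟩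
    sumOver f xs * (sumOver g ys * H) ∎
    where
    open ≡-Reasoning
    H = sumOver h zs

  sumOver³-separable : ∀ (f : A → ℕ) (g : B → ℕ) (h : C → ℕ) xs ys zs →
    sumOver³ (λ x y z → f x + g y + h z) xs ys zs
    ≡ sumOver f xs * (length ys * length zs) + length xs * (sumOver g ys * length zs) + length xs * (length ys * sumOver h zs)
  sumOver³-separable f g h xs ys zs = begin
    sumOver³ (λ x y z → f x + g y + h z) xs ys zs
      ≡⟨ sumOver³-cong (λ x y z → units (f x) (g y) (h z)) xs ys zs ⟩
    sumOver³ (λ x y z → f x * (1 * 1) + 1 * (g y * 1) + 1 * (1 * h z)) xs ys zs
      ≡⟨ sumOver³-+₃ _ _ _ xs ys zs ⟩
    _ ≡⟨ cong₂ _+_ (cong₂ _+_ (sumOver³-product f one one xs ys zs) (sumOver³-product one g one xs ys zs))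
                   (sumOver³-product one one h xs ys zs) ⟩
    sumOver f xs * (Σ1 ys * Σ1 zs) + Σ1 xs * (sumOver g ys * Σ1 zs) + Σ1 xs * (Σ1 ys * sumOver h zs)
      ≡⟨ cong₂ _+_ (cong₂ _+_ (cong₂ (λ p q → sumOver f xs * (p * q)) (Σ1≡length ys) (Σ1≡length zs))
                              (cong₂ (λ p q → p * (sumOver g ys * q)) (Σ1≡length xs) (Σ1≡length zs)))
                   (cong₂ (λ p q → p * (q * sumOver h zs)) (Σ1≡length xs) (Σ1≡length ys)) ⟩
    sumOver f xs * (length ys * length zs) + length xs * (sumOver g ys * length zs) + length xs * (length ys * sumOver h zs) ∎
    where
    open ≡-Reasoning
    one : ∀ {D : Set} → D → ℕ
    one _ = 1
    Σ1 : ∀ {D : Set} → List D → ℕ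
    Σ1 = sumOver one
    Σ1≡length : ∀ {D : Set} (ds : List D) → Σ1 ds ≡ length ds
    Σ1≡length ds = trans (sumOver-const 1 ds) (*-identityˡ (length ds))
    units : ∀ p q r → p + q + r ≡ p * (1 * 1) + 1 * (q * 1) + 1 * (1 * r)
    units = solve-∀

sumOver³-rotate : ∀ {A B C : Set} (f : A → B → C → ℕ) xs ys zs →
  sumOver³ f xs ys zs ≡ sumOver (λ z → sumOver (λ x → sumOver (λ y → f x y z) ys) xs) zs
sumOver³-rotate f xs ys zs =
  trans (sumOver-cong (λ x → sumOver-comm (f x) ys zs) xs) (sumOver-comm (λ x z → sumOver (λ y → f x y z) ys) xs zs)

-- The surface-area lower bound

≡ᵇ-sym : ∀ m n → (m ≡ᵇ n) ≡ (n ≡ᵇ m)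
≡ᵇ-sym zero    zero    = refl
≡ᵇ-sym zero    (suc n) = refl
≡ᵇ-sym (suc m) zero    = refl
≡ᵇ-sym (suc m) (suc n) = ≡ᵇ-sym m n

diff1-sym : ∀ m n → diff1 m n ≡ diff1 n m
diff1-sym m n = ∨-comm (suc m ≡ᵇ n) (suc n ≡ᵇ m)

adj-sym : ∀ {a₁ a₂ a₃} (v w : Vertex a₁ a₂ a₃) → adj v w ≡ adj w v
adj-sym (x₁ , x₂ , x₃) (y₁ , y₂ , y₃)
  rewrite diff1-sym (toℕ x₁) (toℕ y₁) | diff1-sym (toℕ x₂) (toℕ y₂) | diff1-sym (toℕ x₃) (toℕ y₃)
        | ≡ᵇ-sym (toℕ x₁) (toℕ y₁) | ≡ᵇ-sym (toℕ x₂) (toℕ y₂) | ≡ᵇ-sym (toℕ x₃) (toℕ y₃) = refl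

∈-vertices : ∀ {a₁ a₂ a₃} (v : Vertex a₁ a₂ a₃) → v ∈ vertices a₁ a₂ a₃
∈-vertices (x , y , z) = ∈-cartesianProduct⁺ (∈-allFin x) (∈-cartesianProduct⁺ (∈-allFin y) (∈-allFin z))

iter-mono : ∀ {a₁ a₂ a₃} r (A : VSet a₁ a₂ a₃) {s t} v →
            s ≤ t → iter r A s v ≡ true → iter r A t v ≡ true
iter-mono r A {s} {t} v s≤t infected = subst (λ t → iter r A t v ≡ true) (m+[n∸m]≡n s≤t) (later (t ∸ s))
  where
  later : ∀ k → iter r A (s + k) v ≡ true
  later zero    = subst (λ t → iter r A t v ≡ true) (sym (+-identityʳ s)) infected
  later (suc k) rewrite +-suc s k | later k = refl

percolation-time : ∀ {a₁ a₂ a₃} r (A : VSet a₁ a₂ a₃) → Percolates r A →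
                   ∃[ t ] (∀ v → iter r A t v ≡ true)
percolation-time {a₁} {a₂} {a₃} r A percolates with uniform (vertices a₁ a₂ a₃)
  where
  uniform : ∀ vs → ∃[ t ] All (λ v → iter r A t v ≡ true) vs
  uniform []       = 0 , []
  uniform (v ∷ vs) with percolates v | uniform vs
  ... | s , sv | t , tvs =
    s ⊔ t , iter-mono r A v (m≤m⊔n s t) sv ∷ All.map (λ {w} → iter-mono r A w (m≤n⊔m s t)) tvs
... | t , infected = t , λ v → All.lookup infected (∈-vertices v)

-- Non-increasing h - k, stated without truncated subtraction.
difference-antitone : (h k : ℕ → ℕ) → (∀ t → h (suc t) + k t ≤ h t + k (suc t)) →
                      ∀ t → h t + k 0 ≤ h 0 + k t
difference-antitone h k decreasing zero    = ≤-refl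
difference-antitone h k decreasing (suc t) = +-cancelʳ-≤ (h t + k t) _ _ (begin
  h (suc t) + k 0 + (h t + k t)      ≡⟨ shuffle (h (suc t)) (k 0) (h t) (k t) ⟩
  h (suc t) + k t + (h t + k 0)      ≤⟨ +-mono-≤ (decreasing t) (difference-antitone h k decreasing t) ⟩
  h t + k (suc t) + (h 0 + k t)      ≡⟨ shuffle′ (h t) (k (suc t)) (h 0) (k t) ⟩
  h 0 + k (suc t) + (h t + k t)      ∎)
  where
  open ≤-Reasoning
  shuffle : ∀ a b c d → a + b + (c + d) ≡ a + d + (c + b)
  shuffle = solve-∀
  shuffle′ : ∀ a b c d → a + b + (c + d) ≡ c + b + (a + d)
  shuffle′ = solve-∀

module Grid {a₁ a₂ a₃ : ℕ} where

  V : Set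
  V = Vertex a₁ a₂ a₃

  L : List V
  L = vertices a₁ a₂ a₃

  size≡count : ∀ (X : VSet a₁ a₂ a₃) → size X ≡ count X L
  size≡count X = length-filter≡count X L

  nbrCount≡sum : ∀ (X : VSet a₁ a₂ a₃) v → nbrCount X v ≡ sumOver (λ w → ind (adj v w) * ind (X w)) L
  nbrCount≡sum X v = trans (length-filter≡count (λ w → adj v w ∧ X w) L) (sumOver-cong (λ w → ind-∧ (adj v w) (X w)) L)

  edgesBetween : VSet a₁ a₂ a₃ → VSet a₁ a₂ a₃ → ℕ
  edgesBetween X Y = sumOver (λ v → sumOver (λ w → ind (X v) * (ind (adj v w) * ind (Y w))) L) L

  edgesBetween-comm : ∀ X Y → edgesBetween X Y ≡ edgesBetween Y X
  edgesBetween-comm X Y = begin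
    edgesBetween X Y
      ≡⟨ sumOver-cong (λ v → sumOver-cong (λ w → swap v w) L) L ⟩
    sumOver (λ v → sumOver (λ w → ind (Y w) * (ind (adj w v) * ind (X v))) L) L
      ≡⟨ sumOver-comm (λ v w → ind (Y w) * (ind (adj w v) * ind (X v))) L L ⟩
    edgesBetween Y X ∎
    where
    open ≡-Reasoning
    reorder : ∀ x a y → x * (a * y) ≡ y * (a * x)
    reorder = solve-∀
    swap : ∀ v w → ind (X v) * (ind (adj v w) * ind (Y w)) ≡ ind (Y w) * (ind (adj w v) * ind (X v))
    swap v w = trans (reorder (ind (X v)) (ind (adj v w)) (ind (Y w))) (cong (λ b → ind (Y w) * (ind b * ind (X v))) (adj-sym v w))

  edgesBetween≡nbrCount : ∀ X Y → edgesBetween X Y ≡ sumOver (λ v → ind (X v) * nbrCount Y v) L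
  edgesBetween≡nbrCount X Y =
    sumOver-cong (λ v → trans (sumOver-*ˡ (ind (X v)) _ L) (cong (ind (X v) *_) (sym (nbrCount≡sum Y v)))) L

  edgesBetween-disjointUnion : ∀ X B Z → (∀ v → ind (Z v) ≡ ind (X v) + ind (B v)) →
    edgesBetween X X + edgesBetween B X + edgesBetween X B ≤ edgesBetween Z Z
  edgesBetween-disjointUnion X B Z Z≡X+B = begin
    edgesBetween X X + edgesBetween B X + edgesBetween X B
      ≡⟨ split ⟨
    sumOver (λ v → sumOver (λ w → term X X v w + term B X v w + term X B v w) L) L
      ≤⟨ sumOver-mono (λ v → sumOver-mono (λ w → pointwise v w) L) L ⟩
    edgesBetween Z Z ∎
    where
    open ≤-Reasoning
    term : VSet a₁ a₂ a₃ → VSet a₁ a₂ a₃ → V → V → ℕ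
    term P Q v w = ind (P v) * (ind (adj v w) * ind (Q w))
    split : sumOver (λ v → sumOver (λ w → term X X v w + term B X v w + term X B v w) L) L
            ≡ edgesBetween X X + edgesBetween B X + edgesBetween X B
    split = trans (sumOver-cong (λ v → sumOver-+₃ (term X X v) (term B X v) (term X B v) L) L)
                  (sumOver-+₃ (λ v → sumOver (term X X v) L) (λ v → sumOver (term B X v) L) (λ v → sumOver (term X B v) L) L)
    expand : ∀ x b e y c → x * (e * y) + b * (e * y) + x * (e * c) + b * (e * c) ≡ (x + b) * (e * (y + c))
    expand = solve-∀
    pointwise : ∀ v w → term X X v w + term B X v w + term X B v w ≤ term Z Z v w
    pointwise v w rewrite Z≡X+B v | Z≡X+B w =
      ≤-trans (m≤m+n _ _) (≤-reflexive (expand (ind (X v)) (ind (B v)) (ind (adj v w)) (ind (X w)) (ind (B w))))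

  degreeSum : ℕ
  degreeSum = sumOver (λ v → count (adj v) L) L

  edgesBetween-all : ∀ X → (∀ v → X v ≡ true) → edgesBetween X X ≡ degreeSum
  edgesBetween-all X everywhere = sumOver-cong (λ v → sumOver-cong (λ w → full v w) L) L
    where
    full : ∀ v w → ind (X v) * (ind (adj v w) * ind (X w)) ≡ ind (adj v w)
    full v w rewrite everywhere v | everywhere w = trans (+-identityʳ _) (*-identityʳ _)

  module _ (r : ℕ) where

    newlyInfected : VSet a₁ a₂ a₃ → VSet a₁ a₂ a₃
    newlyInfected X v = not (X v) ∧ (r ≤ᵇ nbrCount X v)

    ind-step : ∀ X v → ind (step r X v) ≡ ind (X v) + ind (newlyInfected X v)
    ind-step X v with X v
    ... | true  = refl
    ... | false = refl

    newlyInfected-nbrCount : ∀ X v → ind (newlyInfected X v) * r ≤ ind (newlyInfected X v) * nbrCount X v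
    newlyInfected-nbrCount X v with X v | r ≤ᵇ nbrCount X v in r≤?
    ... | true  | _     = z≤n
    ... | false | false = z≤n
    ... | false | true  = +-monoˡ-≤ 0 (≤ᵇ⇒≤ r (nbrCount X v) (subst T (sym r≤?) _))

    -- Each newly infected vertex has at least r infected neighbours, contributing 2r ordered pairs.
    edgesBetween-step : ∀ X → edgesBetween X X + count (newlyInfected X) L * (2 * r)
                              ≤ edgesBetween (step r X) (step r X)
    edgesBetween-step X = begin
      edgesBetween X X + count B L * (2 * r)
        ≡⟨ double (edgesBetween X X) (count B L) r ⟩
      edgesBetween X X + count B L * r + count B L * r
        ≤⟨ +-mono-≤ (+-monoʳ-≤ (edgesBetween X X) newly≤) (≤-trans newly≤ (≤-reflexive (edgesBetween-comm B X))) ⟩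
      edgesBetween X X + edgesBetween B X + edgesBetween X B
        ≤⟨ edgesBetween-disjointUnion X B (step r X) (ind-step X) ⟩
      edgesBetween (step r X) (step r X) ∎
      where
      open ≤-Reasoning
      B = newlyInfected X
      double : ∀ e c r → e + c * (2 * r) ≡ e + c * r + c * r
      double = solve-∀
      newly≤ : count B L * r ≤ edgesBetween B X
      newly≤ = begin
        count B L * r                       ≡⟨ sumOver-*ʳ r (λ v → ind (B v)) L ⟨
        sumOver (λ v → ind (B v) * r) L     ≤⟨ sumOver-mono (newlyInfected-nbrCount X) L ⟩
        sumOver (λ v → ind (B v) * nbrCount X v) L ≡⟨ edgesBetween≡nbrCount B X ⟨
        edgesBetween B X                    ∎

    potential-step : ∀ X → 2 * r * count (step r X) L + edgesBetween X X
                           ≤ 2 * r * count X L + edgesBetween (step r X) (step r X)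
    potential-step X = begin
      2 * r * count (step r X) L + edgesBetween X X
        ≡⟨ cong (λ c → 2 * r * c + edgesBetween X X) (trans (sumOver-cong (ind-step X) L) (sumOver-+ _ _ L)) ⟩
      2 * r * (count X L + count (newlyInfected X) L) + edgesBetween X X
        ≡⟨ regroup r (count X L) (count (newlyInfected X) L) (edgesBetween X X) ⟩
      2 * r * count X L + (edgesBetween X X + count (newlyInfected X) L * (2 * r))
        ≤⟨ +-monoʳ-≤ (2 * r * count X L) (edgesBetween-step X) ⟩
      2 * r * count X L + edgesBetween (step r X) (step r X) ∎
      where
      open ≤-Reasoning
      regroup : ∀ r c b e → 2 * r * (c + b) + e ≡ 2 * r * c + (e + b * (2 * r))
      regroup = solve-∀

    percolating-lowerBound : ∀ A → Percolates r A → 2 * r * length L ≤ 2 * r * size A + degreeSum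
    percolating-lowerBound A percolates with percolation-time r A percolates
    ... | t , infected = begin
      2 * r * length L                               ≡⟨ cong (2 * r *_) everyone ⟨
      2 * r * count (iter r A t) L                    ≤⟨ m≤m+n _ _ ⟩
      2 * r * count (iter r A t) L + edgesBetween A A ≤⟨ difference-antitone h k (λ t → potential-step (iter r A t)) t ⟩
      2 * r * count A L + edgesBetween (iter r A t) (iter r A t)
        ≡⟨ cong₂ _+_ (cong (2 * r *_) (sym (size≡count A))) (edgesBetween-all (iter r A t) infected) ⟩
      2 * r * size A + degreeSum                      ∎
      where
      open ≤-Reasoning
      everyone : count (iter r A t) L ≡ length L
      everyone = trans (sumOver-cong (λ v → cong ind (infected v)) L) (trans (sumOver-const 1 L) (*-identityˡ _))
      h k : ℕ → ℕ
      h t = 2 * r * count (iter r A t) L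
      k t = edgesBetween (iter r A t) (iter r A t)

ind-∨ : ∀ b c → (b ∧ c) ≡ false → ind (b ∨ c) ≡ ind b + ind c
ind-∨ false c     _  = refl
ind-∨ true  false _  = refl
ind-∨ true  true  ()

∧-exclusive : ∀ d e x y → (d ∧ e) ≡ false → ((d ∧ x) ∧ (e ∧ y)) ≡ false
∧-exclusive false e x y _       = refl
∧-exclusive true  e x y e≡false rewrite e≡false = ∧-zeroʳ x

∧-exclusive′ : ∀ d e u x u′ y → (d ∧ e) ≡ false → ((u ∧ (d ∧ x)) ∧ (u′ ∧ (e ∧ y))) ≡ false
∧-exclusive′ d e false x u′    y _         = refl
∧-exclusive′ d e true  x false y _         = ∧-zeroʳ (d ∧ x)
∧-exclusive′ d e true  x true  y d∧e≡false = ∧-exclusive d e x y d∧e≡false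

suc-≡ᵇ-exclusive : ∀ i j → ((suc i ≡ᵇ j) ∧ (suc j ≡ᵇ i)) ≡ false
suc-≡ᵇ-exclusive zero    j       = ∧-zeroʳ (1 ≡ᵇ j)
suc-≡ᵇ-exclusive (suc i) zero    = refl
suc-≡ᵇ-exclusive (suc i) (suc j) = suc-≡ᵇ-exclusive i j

diff1-eqℕ-exclusive : ∀ i j → (diff1 i j ∧ eqℕ i j) ≡ false
diff1-eqℕ-exclusive zero    zero    = refl
diff1-eqℕ-exclusive zero    (suc j) = ∧-zeroʳ (diff1 0 (suc j))
diff1-eqℕ-exclusive (suc i) zero    = ∧-zeroʳ (diff1 (suc i) 0)
diff1-eqℕ-exclusive (suc i) (suc j) = diff1-eqℕ-exclusive i j

module _ {n : ℕ} where

  δ₁ δ : Fin n → Fin n → ℕ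
  δ₁ i j = ind (diff1 (toℕ i) (toℕ j))
  δ i j = ind (eqℕ (toℕ i) (toℕ j))

ind-adj : ∀ {a₁ a₂ a₃} (v w : Vertex a₁ a₂ a₃) → let (x , y , z) = v ; (x′ , y′ , z′) = w in
  ind (adj v w)
  ≡ δ₁ x x′ * (δ y y′ * δ z z′) + δ x x′ * (δ₁ y y′ * δ z z′) + δ x x′ * (δ y y′ * δ₁ z z′)
ind-adj (x , y , z) (x′ , y′ , z′) = begin
  ind (d₁ ∧ e₂ ∧ e₃ ∨ e₁ ∧ d₂ ∧ e₃ ∨ e₁ ∧ e₂ ∧ d₃)
    ≡⟨ ind-∨₃ (d₁ ∧ e₂ ∧ e₃) (e₁ ∧ d₂ ∧ e₃) (e₁ ∧ e₂ ∧ d₃)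
              (∧-exclusive d₁ e₁ (e₂ ∧ e₃) (d₂ ∧ e₃) (diff1-eqℕ-exclusive (toℕ x) (toℕ x′)))
              (∧-exclusive d₁ e₁ (e₂ ∧ e₃) (e₂ ∧ d₃) (diff1-eqℕ-exclusive (toℕ x) (toℕ x′)))
              (∧-exclusive′ d₂ e₂ e₁ e₃ e₁ d₃ (diff1-eqℕ-exclusive (toℕ y) (toℕ y′))) ⟩
  ind (d₁ ∧ e₂ ∧ e₃) + ind (e₁ ∧ d₂ ∧ e₃) + ind (e₁ ∧ e₂ ∧ d₃)
    ≡⟨ cong₂ _+_ (cong₂ _+_ (ind-∧₃ d₁ e₂ e₃) (ind-∧₃ e₁ d₂ e₃)) (ind-∧₃ e₁ e₂ d₃) ⟩
  δ₁ x x′ * (δ y y′ * δ z z′) + δ x x′ * (δ₁ y y′ * δ z z′) + δ x x′ * (δ y y′ * δ₁ z z′) ∎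
  where
  open ≡-Reasoning
  d₁ = diff1 (toℕ x) (toℕ x′)
  d₂ = diff1 (toℕ y) (toℕ y′)
  d₃ = diff1 (toℕ z) (toℕ z′)
  e₁ = eqℕ (toℕ x) (toℕ x′)
  e₂ = eqℕ (toℕ y) (toℕ y′)
  e₃ = eqℕ (toℕ z) (toℕ z′)
  ind-∧₃ : ∀ b c d → ind (b ∧ c ∧ d) ≡ ind b * (ind c * ind d)
  ind-∧₃ b c d = trans (ind-∧ b (c ∧ d)) (cong (ind b *_) (ind-∧ c d))

count-≡ᵇ : ∀ k n → count (λ (j : Fin n) → k ≡ᵇ toℕ j) (allFin n) ≡ ind (k <ᵇ n)
count-≡ᵇ k       zero    = refl
count-≡ᵇ zero    (suc n) = trans (sumOver-allFin-suc n (λ j → ind (0 ≡ᵇ toℕ j))) (cong suc (sumOver-zero (allFin n)))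
count-≡ᵇ (suc k) (suc n) = trans (sumOver-allFin-suc n (λ j → ind (suc k ≡ᵇ toℕ j))) (count-≡ᵇ k n)

count-δ : ∀ {n} (i : Fin n) → sumOver (δ i) (allFin n) ≡ 1
count-δ {n} i = trans (count-≡ᵇ (toℕ i) n) (cong ind (Equivalence.to T-≡ (<⇒<ᵇ (toℕ<n i))))

sumOver-vertices : ∀ {a₁ a₂ a₃} (f : Vertex a₁ a₂ a₃ → ℕ) →
  sumOver f (vertices a₁ a₂ a₃) ≡ sumOver³ (λ x y z → f (x , y , z)) (allFin a₁) (allFin a₂) (allFin a₃)
sumOver-vertices {a₁} {a₂} {a₃} f =
  trans (sumOver-cartesianProduct f (allFin a₁) _)
        (sumOver-cong (λ x → sumOver-cartesianProduct (λ yz → f (x , yz)) (allFin a₂) (allFin a₃)) (allFin a₁))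

lineDegree : ∀ {n} → Fin n → ℕ
lineDegree {n} i = sumOver (δ₁ i) (allFin n)

degree-grid : ∀ {a₁ a₂ a₃} (v : Vertex a₁ a₂ a₃) → let (x , y , z) = v in
  count (adj v) (vertices a₁ a₂ a₃) ≡ lineDegree x + lineDegree y + lineDegree z
degree-grid {a₁} {a₂} {a₃} v@(x , y , z) = begin
  count (adj v) (vertices a₁ a₂ a₃)
    ≡⟨ sumOver-vertices (λ w → ind (adj v w)) ⟩
  sumOver³ (λ x′ y′ z′ → ind (adj v (x′ , y′ , z′))) xs ys zs
    ≡⟨ sumOver³-cong (λ x′ y′ z′ → ind-adj v (x′ , y′ , z′)) xs ys zs ⟩
  sumOver³ (λ x′ y′ z′ → δ₁ x x′ * (δ y y′ * δ z z′) + δ x x′ * (δ₁ y y′ * δ z z′)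
                         + δ x x′ * (δ y y′ * δ₁ z z′)) xs ys zs
    ≡⟨ sumOver³-+₃ _ _ _ xs ys zs ⟩
  _ ≡⟨ cong₂ _+_ (cong₂ _+_ (sumOver³-product (δ₁ x) (δ y) (δ z) xs ys zs)
                            (sumOver³-product (δ x) (δ₁ y) (δ z) xs ys zs))
                 (sumOver³-product (δ x) (δ y) (δ₁ z) xs ys zs) ⟩
  lineDegree x * (S y * S z) + S x * (lineDegree y * S z) + S x * (S y * lineDegree z)
    ≡⟨ cong₂ _+_ (cong₂ _+_ (cong₂ (λ p q → lineDegree x * (p * q)) (count-δ y) (count-δ z))
                            (cong₂ (λ p q → p * (lineDegree y * q)) (count-δ x) (count-δ z)))
                 (cong₂ (λ p q → p * (q * lineDegree z)) (count-δ x) (count-δ y)) ⟩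
  lineDegree x * (1 * 1) + 1 * (lineDegree y * 1) + 1 * (1 * lineDegree z)
    ≡⟨ units (lineDegree x) (lineDegree y) (lineDegree z) ⟩
  lineDegree x + lineDegree y + lineDegree z ∎
  where
  open ≡-Reasoning
  xs = allFin a₁
  ys = allFin a₂
  zs = allFin a₃
  S : ∀ {n} → Fin n → ℕ
  S {n} i = sumOver (δ i) (allFin n)
  units : ∀ p q r → p * (1 * 1) + 1 * (q * 1) + 1 * (1 * r) ≡ p + q + r
  units = solve-∀

count-suc<ᵇ : ∀ n → count (λ (i : Fin n) → suc (toℕ i) <ᵇ n) (allFin n) ≡ pred n
count-suc<ᵇ zero    = refl
count-suc<ᵇ (suc n) = trans (sumOver-allFin-suc n (λ i → ind (suc (toℕ i) <ᵇ suc n)))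
                            (trans (cong (ind (0 <ᵇ n) +_) (count-suc<ᵇ n)) (positive n))
  where
  positive : ∀ n → ind (0 <ᵇ n) + pred n ≡ n
  positive zero    = refl
  positive (suc n) = refl

-- Both orientations of each of the pred n edges of a path on n vertices.
sumOver-lineDegree : ∀ n → sumOver (lineDegree {n}) (allFin n) ≡ 2 * pred n
sumOver-lineDegree n = begin
  sumOver (λ i → sumOver (δ₁ i) is) is
    ≡⟨ sumOver-cong (λ i → trans (sumOver-cong (split i) is) (sumOver-+ (forward i) (λ j → forward j i) is)) is ⟩
  sumOver (λ i → sumOver (forward i) is + sumOver (λ j → forward j i) is) is
    ≡⟨ sumOver-+ _ _ is ⟩
  sumOver (λ i → sumOver (forward i) is) is + sumOver (λ i → sumOver (λ j → forward j i) is) is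
    ≡⟨ cong (sumOver (λ i → sumOver (forward i) is) is +_) (sumOver-comm (λ i j → forward j i) is is) ⟩
  F + F
    ≡⟨ cong₂ _+_ edges edges ⟩
  pred n + pred n
    ≡⟨ cong (pred n +_) (+-identityʳ (pred n)) ⟨
  2 * pred n ∎
  where
  open ≡-Reasoning
  is = allFin n
  forward : Fin n → Fin n → ℕ
  forward i j = ind (suc (toℕ i) ≡ᵇ toℕ j)
  split : ∀ i j → δ₁ i j ≡ forward i j + forward j i
  split i j = ind-∨ (suc (toℕ i) ≡ᵇ toℕ j) (suc (toℕ j) ≡ᵇ toℕ i) (suc-≡ᵇ-exclusive (toℕ i) (toℕ j))
  F = sumOver (λ i → sumOver (forward i) is) is
  edges : F ≡ pred n
  edges = trans (sumOver-cong (λ i → count-≡ᵇ (suc (toℕ i)) n) is) (count-suc<ᵇ n)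

degreeSum-grid : ∀ a₁ a₂ a₃ → Grid.degreeSum {a₁} {a₂} {a₃}
                 ≡ 2 * (pred a₁ * (a₂ * a₃) + a₁ * (pred a₂ * a₃) + a₁ * (a₂ * pred a₃))
degreeSum-grid a₁ a₂ a₃ = begin
  sumOver (λ v → count (adj v) (vertices a₁ a₂ a₃)) (vertices a₁ a₂ a₃)
    ≡⟨ sumOver-vertices (λ v → count (adj v) (vertices a₁ a₂ a₃)) ⟩
  sumOver³ (λ x y z → count (adj (x , y , z)) (vertices a₁ a₂ a₃)) xs ys zs
    ≡⟨ sumOver³-cong (λ x y z → degree-grid (x , y , z)) xs ys zs ⟩
  sumOver³ (λ x y z → lineDegree x + lineDegree y + lineDegree z) xs ys zs
    ≡⟨ sumOver³-separable lineDegree lineDegree lineDegree xs ys zs ⟩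
  sumOver lineDegree xs * (length ys * length zs) + length xs * (sumOver lineDegree ys * length zs)
    + length xs * (length ys * sumOver lineDegree zs)
    ≡⟨ cong₂ _+_ (cong₂ _+_ (cong₂ _*_ (sumOver-lineDegree a₁) (cong₂ _*_ (length-allFin a₂) (length-allFin a₃)))
                            (cong₂ _*_ (length-allFin a₁) (cong₂ _*_ (sumOver-lineDegree a₂) (length-allFin a₃))))
                 (cong₂ _*_ (length-allFin a₁) (cong₂ _*_ (length-allFin a₂) (sumOver-lineDegree a₃))) ⟩
  2 * pred a₁ * (a₂ * a₃) + a₁ * (2 * pred a₂ * a₃) + a₁ * (a₂ * (2 * pred a₃))
    ≡⟨ factor (pred a₁) (pred a₂) (pred a₃) a₁ a₂ a₃ ⟩
  2 * (pred a₁ * (a₂ * a₃) + a₁ * (pred a₂ * a₃) + a₁ * (a₂ * pred a₃)) ∎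
  where
  open ≡-Reasoning
  xs = allFin a₁
  ys = allFin a₂
  zs = allFin a₃
  factor : ∀ p₁ p₂ p₃ a₁ a₂ a₃ → 2 * p₁ * (a₂ * a₃) + a₁ * (2 * p₂ * a₃) + a₁ * (a₂ * (2 * p₃))
                                ≡ 2 * (p₁ * (a₂ * a₃) + a₁ * (p₂ * a₃) + a₁ * (a₂ * p₃))
  factor = solve-∀

length-vertices : ∀ a₁ a₂ a₃ → length (vertices a₁ a₂ a₃) ≡ a₁ * (a₂ * a₃)
length-vertices a₁ a₂ a₃ = begin
  length (vertices a₁ a₂ a₃)
    ≡⟨ length-cartesianProduct (allFin a₁) _ ⟩
  length (allFin a₁) * length (cartesianProduct (allFin a₂) (allFin a₃))
    ≡⟨ cong (length (allFin a₁) *_) (length-cartesianProduct (allFin a₂) (allFin a₃)) ⟩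
  length (allFin a₁) * (length (allFin a₂) * length (allFin a₃))
    ≡⟨ cong₂ _*_ (length-allFin a₁) (cong₂ _*_ (length-allFin a₂) (length-allFin a₃)) ⟩
  a₁ * (a₂ * a₃) ∎
  where open ≡-Reasoning

-- Percolation certified by a rank function

≡ᵇ-refl : ∀ n → (n ≡ᵇ n) ≡ true
≡ᵇ-refl zero    = refl
≡ᵇ-refl (suc n) = ≡ᵇ-refl n

diff1-up : ∀ {m n} → m ≡ suc n → diff1 n m ≡ true
diff1-up {n = n} refl rewrite ≡ᵇ-refl n = refl

diff1-down : ∀ {m n} → suc m ≡ n → diff1 n m ≡ true
diff1-down {m} refl rewrite ≡ᵇ-refl m = ∨-zeroʳ _

data Direction : Set where
  east west north south up down : Direction

offset : Direction → ℤ × ℤ × ℤ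
offset east  = ℤ.+ 1    , ℤ.+ 0    , ℤ.+ 0
offset west  = -[1+ 0 ] , ℤ.+ 0    , ℤ.+ 0
offset north = ℤ.+ 0    , ℤ.+ 1    , ℤ.+ 0
offset south = ℤ.+ 0    , -[1+ 0 ] , ℤ.+ 0
offset up    = ℤ.+ 0    , ℤ.+ 0    , ℤ.+ 1
offset down  = ℤ.+ 0    , ℤ.+ 0    , -[1+ 0 ]

direction : ℤ × ℤ × ℤ → Maybe Direction
direction (ℤ.+ 1    , ℤ.+ 0    , ℤ.+ 0)    = just east
direction (-[1+ 0 ] , ℤ.+ 0    , ℤ.+ 0)    = just west
direction (ℤ.+ 0    , ℤ.+ 1    , ℤ.+ 0)    = just north
direction (ℤ.+ 0    , -[1+ 0 ] , ℤ.+ 0)    = just south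
direction (ℤ.+ 0    , ℤ.+ 0    , ℤ.+ 1)    = just up
direction (ℤ.+ 0    , ℤ.+ 0    , -[1+ 0 ]) = just down
direction _                                = nothing

direction-offset : ∀ d → direction (offset d) ≡ just d
direction-offset east  = refl
direction-offset west  = refl
direction-offset north = refl
direction-offset south = refl
direction-offset up    = refl
direction-offset down  = refl

1+n⊖n : ∀ n → suc n ⊖ n ≡ ℤ.+ 1
1+n⊖n zero    = refl
1+n⊖n (suc n) = trans ([1+m]⊖[1+n]≡m⊖n (suc n) n) (1+n⊖n n)

n⊖1+n : ∀ n → n ⊖ suc n ≡ -[1+ 0 ]
n⊖1+n n = trans (⊖-swap n (suc n)) (cong ℤ.-_ (1+n⊖n n))

module _ {a₁ a₂ a₃ : ℕ} where

  Step : Direction → Vertex a₁ a₂ a₃ → Vertex a₁ a₂ a₃ → Set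
  Step east  (x , y , z) (x′ , y′ , z′) = toℕ x′ ≡ suc (toℕ x) × y′ ≡ y × z′ ≡ z
  Step west  (x , y , z) (x′ , y′ , z′) = suc (toℕ x′) ≡ toℕ x × y′ ≡ y × z′ ≡ z
  Step north (x , y , z) (x′ , y′ , z′) = x′ ≡ x × toℕ y′ ≡ suc (toℕ y) × z′ ≡ z
  Step south (x , y , z) (x′ , y′ , z′) = x′ ≡ x × suc (toℕ y′) ≡ toℕ y × z′ ≡ z
  Step up    (x , y , z) (x′ , y′ , z′) = x′ ≡ x × y′ ≡ y × toℕ z′ ≡ suc (toℕ z)
  Step down  (x , y , z) (x′ , y′ , z′) = x′ ≡ x × y′ ≡ y × suc (toℕ z′) ≡ toℕ z

  adj-along-x : ∀ (x x′ : Fin a₁) (y : Fin a₂) (z : Fin a₃) →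
                diff1 (toℕ x) (toℕ x′) ≡ true → adj (x , y , z) (x′ , y , z) ≡ true
  adj-along-x x x′ y z d rewrite d | ≡ᵇ-refl (toℕ y) | ≡ᵇ-refl (toℕ z) = refl

  adj-along-y : ∀ (x : Fin a₁) (y y′ : Fin a₂) (z : Fin a₃) →
                diff1 (toℕ y) (toℕ y′) ≡ true → adj (x , y , z) (x , y′ , z) ≡ true
  adj-along-y x y y′ z d rewrite d | ≡ᵇ-refl (toℕ x) | ≡ᵇ-refl (toℕ z) = ∨-zeroʳ _

  adj-along-z : ∀ (x : Fin a₁) (y : Fin a₂) (z z′ : Fin a₃) →
                diff1 (toℕ z) (toℕ z′) ≡ true → adj (x , y , z) (x , y , z′) ≡ true
  adj-along-z x y z z′ d
    rewrite d | ≡ᵇ-refl (toℕ x) | ≡ᵇ-refl (toℕ y)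
          | ∨-zeroʳ (diff1 (toℕ y) (toℕ y) ∧ eqℕ (toℕ z) (toℕ z′)) = ∨-zeroʳ _

  Step-adj : ∀ d {v u} → Step d v u → adj v u ≡ true
  Step-adj east  {x , y , z} {x′ , _ , _} (e , refl , refl) = adj-along-x x x′ y z (diff1-up e)
  Step-adj west  {x , y , z} {x′ , _ , _} (e , refl , refl) = adj-along-x x x′ y z (diff1-down e)
  Step-adj north {x , y , z} {_ , y′ , _} (refl , e , refl) = adj-along-y x y y′ z (diff1-up e)
  Step-adj south {x , y , z} {_ , y′ , _} (refl , e , refl) = adj-along-y x y y′ z (diff1-down e)
  Step-adj up    {x , y , z} {_ , _ , z′} (refl , refl , e) = adj-along-z x y z z′ (diff1-up e)
  Step-adj down  {x , y , z} {_ , _ , z′} (refl , refl , e) = adj-along-z x y z z′ (diff1-down e)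

  displacement : Vertex a₁ a₂ a₃ → Vertex a₁ a₂ a₃ → ℤ × ℤ × ℤ
  displacement (x , y , z) (x′ , y′ , z′) = toℕ x′ ⊖ toℕ x , toℕ y′ ⊖ toℕ y , toℕ z′ ⊖ toℕ z

  displacement-Step : ∀ d {v u} → Step d v u → displacement v u ≡ offset d
  displacement-Step east {x , y , z} (e , refl , refl)
    rewrite e | 1+n⊖n (toℕ x) | n⊖n≡0 (toℕ y) | n⊖n≡0 (toℕ z) = refl
  displacement-Step west {x , y , z} {x′ , _ , _} (e , refl , refl)
    rewrite sym e | n⊖1+n (toℕ x′) | n⊖n≡0 (toℕ y) | n⊖n≡0 (toℕ z) = refl
  displacement-Step north {x , y , z} (refl , e , refl)
    rewrite e | 1+n⊖n (toℕ y) | n⊖n≡0 (toℕ x) | n⊖n≡0 (toℕ z) = refl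
  displacement-Step south {x , y , z} {_ , y′ , _} (refl , e , refl)
    rewrite sym e | n⊖1+n (toℕ y′) | n⊖n≡0 (toℕ x) | n⊖n≡0 (toℕ z) = refl
  displacement-Step up {x , y , z} (refl , refl , e)
    rewrite e | 1+n⊖n (toℕ z) | n⊖n≡0 (toℕ x) | n⊖n≡0 (toℕ y) = refl
  displacement-Step down {x , y , z} {_ , _ , z′} (refl , refl , e)
    rewrite sym e | n⊖1+n (toℕ z′) | n⊖n≡0 (toℕ x) | n⊖n≡0 (toℕ y) = refl

  Step-injective : ∀ {d d′ v u} → Step d v u → Step d′ v u → d ≡ d′
  Step-injective {d} {d′} s s′ = just-injective (begin
    just d                ≡⟨ direction-offset d ⟨
    direction (offset d)  ≡⟨ cong direction (trans (sym (displacement-Step d s)) (displacement-Step d′ s′)) ⟩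
    direction (offset d′) ≡⟨ direction-offset d′ ⟩
    just d′               ∎)
    where open ≡-Reasoning

module _ {A : Set} (_≟_ : DecidableEquality A) where

  count-∈ : ∀ {u xs} → u ∈ xs → 1 ≤ count (λ w → does (w ≟ u)) xs
  count-∈ {u} (here refl) with u ≟ u
  ... | yes _  = s≤s z≤n
  ... | no u≢u = ⊥-elim (u≢u refl)
  count-∈ {u} {x ∷ xs} (there u∈xs) = ≤-trans (count-∈ u∈xs) (m≤n+m _ (ind (does (x ≟ u))))

  count-≥3 : ∀ (p : A → Bool) {xs u₁ u₂ u₃} → u₁ ≢ u₂ → u₁ ≢ u₃ → u₂ ≢ u₃ →
             u₁ ∈ xs → u₂ ∈ xs → u₃ ∈ xs →
             p u₁ ≡ true → p u₂ ≡ true → p u₃ ≡ true → 3 ≤ count p xs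
  count-≥3 p {xs} {u₁} {u₂} {u₃} u₁≢u₂ u₁≢u₃ u₂≢u₃ u₁∈ u₂∈ u₃∈ pu₁ pu₂ pu₃ = begin
    3
      ≤⟨ +-mono-≤ (+-mono-≤ (count-∈ u₁∈) (count-∈ u₂∈)) (count-∈ u₃∈) ⟩
    count (is u₁) xs + count (is u₂) xs + count (is u₃) xs
      ≡⟨ sumOver-+₃ _ _ _ xs ⟨
    sumOver (λ w → ind (is u₁ w) + ind (is u₂ w) + ind (is u₃ w)) xs
      ≤⟨ sumOver-mono one-of xs ⟩
    count p xs ∎
    where
    open ≤-Reasoning
    is : A → A → Bool
    is u w = does (w ≟ u)
    one-of : ∀ w → ind (is u₁ w) + ind (is u₂ w) + ind (is u₃ w) ≤ ind (p w)
    one-of w with w ≟ u₁ | w ≟ u₂ | w ≟ u₃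
    ... | yes refl | yes refl | _        = ⊥-elim (u₁≢u₂ refl)
    ... | yes refl | no _     | yes refl = ⊥-elim (u₁≢u₃ refl)
    ... | no _     | yes refl | yes refl = ⊥-elim (u₂≢u₃ refl)
    ... | yes refl | no _     | no _     rewrite pu₁ = ≤-refl
    ... | no _     | yes refl | no _     rewrite pu₂ = ≤-refl
    ... | no _     | no _     | yes refl rewrite pu₃ = ≤-refl
    ... | no _     | no _     | no _     = z≤n

data ThreeDistinct {A : Set} (P : A → Set) : Set where
  distinct : ∀ {a b c} → a ≢ b → a ≢ c → b ≢ c → P a → P b → P c → ThreeDistinct P

module RankedPercolation {a₁ a₂ a₃} (A : VSet a₁ a₂ a₃) (rank : Vertex a₁ a₂ a₃ → ℕ) where

  Supported : Vertex a₁ a₂ a₃ → Direction → Set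
  Supported v d = ∃[ u ] Step d v u × (A u ≡ true ⊎ rank u < rank v)

  Eventually : Vertex a₁ a₂ a₃ → Set
  Eventually v = ∃[ t ] iter 3 A t v ≡ true

  _≟ᵛ_ : DecidableEquality (Vertex a₁ a₂ a₃)
  _≟ᵛ_ = ≡-dec _≟ᶠ_ (≡-dec _≟ᶠ_ _≟ᶠ_)

  eventually-three : ∀ v {u₁ u₂ u₃} → u₁ ≢ u₂ → u₁ ≢ u₃ → u₂ ≢ u₃ →
    adj v u₁ ≡ true → adj v u₂ ≡ true → adj v u₃ ≡ true →
    Eventually u₁ → Eventually u₂ → Eventually u₃ → Eventually v
  eventually-three v {u₁} {u₂} {u₃} u₁≢u₂ u₁≢u₃ u₂≢u₃ adj₁ adj₂ adj₃ (t₁ , e₁) (t₂ , e₂) (t₃ , e₃) =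
    suc t , trans (cong (X v ∨_) (Equivalence.to T-≡ (≤⇒≤ᵇ three))) (∨-zeroʳ (X v))
    where
    t = t₁ ⊔ t₂ ⊔ t₃
    X = iter 3 A t
    infected : ∀ {u s} → adj v u ≡ true → s ≤ t → iter 3 A s u ≡ true → (adj v u ∧ X u) ≡ true
    infected {u} a s≤t e rewrite a = iter-mono 3 A u s≤t e
    three : 3 ≤ nbrCount X v
    three = subst (3 ≤_) (sym (length-filter≡count (λ w → adj v w ∧ X w) (vertices a₁ a₂ a₃)))
      (count-≥3 _≟ᵛ_ (λ w → adj v w ∧ X w) u₁≢u₂ u₁≢u₃ u₂≢u₃
        (∈-vertices u₁) (∈-vertices u₂) (∈-vertices u₃)
        (infected adj₁ (≤-trans (m≤m⊔n t₁ t₂) (m≤m⊔n _ t₃)) e₁)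
        (infected adj₂ (≤-trans (m≤n⊔m t₁ t₂) (m≤m⊔n _ t₃)) e₂)
        (infected adj₃ (m≤n⊔m _ t₃) e₃))

  percolates-by-rank : (∀ v → A v ≡ false → ThreeDistinct (Supported v)) → Percolates 3 A
  percolates-by-rank certificate v = eventually (suc (rank v)) v ≤-refl
    where
    eventually : ∀ n v → rank v < n → Eventually v
    eventually (suc n) v rank<n with A v in seed?
    ... | true  = 0 , seed?
    ... | false with certificate v seed?
    ...   | distinct d₁≢d₂ d₁≢d₃ d₂≢d₃ (u₁ , s₁ , o₁) (u₂ , s₂ , o₂) (u₃ , s₃ , o₃) =
      eventually-three v (apart s₁ s₂ d₁≢d₂) (apart s₁ s₃ d₁≢d₃) (apart s₂ s₃ d₂≢d₃)
        (Step-adj _ s₁) (Step-adj _ s₂) (Step-adj _ s₃) (neighbour o₁) (neighbour o₂) (neighbour o₃)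
      where
      apart : ∀ {d d′ u u′} → Step d v u → Step d′ v u′ → d ≢ d′ → u ≢ u′
      apart s s′ d≢d′ refl = d≢d′ (Step-injective s s′)
      neighbour : ∀ {u} → A u ≡ true ⊎ rank u < rank v → Eventually u
      neighbour (inj₁ seed)  = 0 , seed
      neighbour (inj₂ lower) = eventually n _ (<-≤-trans lower (s≤s⁻¹ rank<n))

-- The seed set for [3] × [6] × [a]

data Layer : Set where
  bottom odd even penultimate top : Layer

middle : ℕ → Layer
middle zero          = odd
middle (suc zero)    = even
middle (suc (suc n)) = middle n

-- The layer at height z above the bottom and w below the top.
layerOf : ℕ → ℕ → Layer
layerOf _       zero                = top
layerOf _       (suc zero)          = penultimate
layerOf zero    (suc (suc _))       = bottom
layerOf (suc z) (suc (suc _))       = middle z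

data Cell : Set where
  seed   : Cell
  ranked : ℕ → ℕ → ℕ → Cell

isSeed : Cell → Bool
isSeed seed = true
isSeed (ranked _ _ _) = false

rankOf : Cell → ℕ → ℕ → ℕ
rankOf seed             _ _ = 0
rankOf (ranked e₀ e₁ e₂) z w = e₀ + e₁ * z + e₂ * w

zCoeff wCoeff : Cell → ℕ
zCoeff seed             = 0
zCoeff (ranked _ e₁ _) = e₁
wCoeff seed             = 0
wCoeff (ranked _ _ e₂) = e₂

layout : Layer → Vec (Vec Cell 6) 3
layout bottom =
  (ranked 11 0 2 ∷ ranked 10 0 2 ∷ ranked 9 0 2 ∷ ranked 8 0 2 ∷ ranked 7 0 2 ∷ seed          ∷ []) ∷
  (seed          ∷ ranked 1 0 0  ∷ seed         ∷ ranked 5 0 2 ∷ ranked 6 0 2 ∷ ranked 7 0 2  ∷ []) ∷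
  (ranked 1 0 0  ∷ seed          ∷ ranked 1 0 2 ∷ ranked 2 0 2 ∷ seed         ∷ ranked 8 0 2  ∷ []) ∷ []
layout odd =
  (ranked 1 1 2  ∷ seed          ∷ ranked 3 1 2 ∷ ranked 6 1 2 ∷ ranked 7 1 2 ∷ ranked 6 3 2  ∷ []) ∷
  (ranked 2 1 0  ∷ ranked 1 1 0  ∷ ranked 2 1 0 ∷ ranked 5 1 2 ∷ ranked 6 1 2 ∷ ranked 7 1 2  ∷ []) ∷
  (seed          ∷ ranked 1 0 0  ∷ ranked 1 1 2 ∷ ranked 2 1 2 ∷ ranked 1 0 0 ∷ seed          ∷ []) ∷ []
layout even =
  (ranked 1 1 2  ∷ ranked 2 1 0  ∷ ranked 3 1 2 ∷ ranked 6 1 2 ∷ ranked 7 1 2 ∷ ranked 6 3 2  ∷ []) ∷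
  (ranked 2 1 0  ∷ ranked 1 1 0  ∷ seed         ∷ ranked 5 1 2 ∷ ranked 6 1 2 ∷ ranked 7 1 2  ∷ []) ∷
  (ranked 1 0 0  ∷ seed          ∷ ranked 1 1 2 ∷ ranked 2 1 2 ∷ seed         ∷ ranked 1 0 0  ∷ []) ∷ []
layout penultimate =
  (ranked 3 1 0  ∷ seed          ∷ ranked 5 1 0 ∷ ranked 6 1 0 ∷ seed         ∷ ranked 8 3 0  ∷ []) ∷
  (ranked 2 1 0  ∷ ranked 1 1 0  ∷ ranked 2 1 0 ∷ ranked 7 1 0 ∷ ranked 8 1 0 ∷ ranked 9 1 0  ∷ []) ∷
  (seed          ∷ ranked 1 0 0  ∷ ranked 3 1 0 ∷ seed         ∷ ranked 1 0 0 ∷ seed          ∷ []) ∷ []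
layout top =
  (seed          ∷ ranked 2 1 0  ∷ ranked 3 1 0 ∷ seed         ∷ ranked 9 1 0 ∷ ranked 6 3 0  ∷ []) ∷
  (ranked 2 1 0  ∷ ranked 1 1 0  ∷ seed         ∷ ranked 7 1 0 ∷ ranked 8 1 0 ∷ seed          ∷ []) ∷
  (ranked 3 1 0  ∷ seed          ∷ ranked 3 1 0 ∷ ranked 8 1 0 ∷ ranked 9 1 0 ∷ ranked 10 1 0 ∷ []) ∷ []

cell : Layer → Fin 3 → Fin 6 → Cell
cell L x y = lookup (lookup (layout L) x) y

-- Local windows, checked by evaluation

grow : Bool → ℕ → ℕ
grow true  p = p
grow false _ = 0

record Window : Set where
  constructor window
  field
    layer        : Layer
    below above  : Maybe Layer
    zMin wMin    : ℕ
    zFree wFree  : Bool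

Below Above : Maybe Layer → ℕ → ℕ → Set
Below nothing   _ _ = ⊤
Below (just L′) z w = ∀ {z′} → z ≡ suc z′ → layerOf z′ (suc w) ≡ L′
Above nothing   _ _ = ⊤
Above (just L′) z w = ∀ {w′} → w ≡ suc w′ → layerOf (suc z) w′ ≡ L′

record Occurs (W : Window) (z w : ℕ) : Set where
  constructor occurs
  open Window W
  field
    p q    : ℕ
    z≡     : z ≡ zMin + grow zFree p
    w≡     : w ≡ wMin + grow wFree q
    layer≡ : layerOf z w ≡ layer
    below≡ : Below below z w
    above≡ : Above above z w

data Case : Set where
  top-over-penultimate penultimate-over-bottom penultimate-over-even bottom-under-penultimate
    bottom-under-odd odd-over-bottom odd-over-even even-between-odds even-under-penultimate : Case

windowOf : Case → Window
windowOf top-over-penultimate     = window top         (just penultimate) nothing            2 0 true  false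
windowOf penultimate-over-bottom  = window penultimate (just bottom)      (just top)         1 1 true  false
windowOf penultimate-over-even    = window penultimate (just even)        (just top)         1 1 true  false
windowOf bottom-under-penultimate = window bottom      nothing            (just penultimate) 0 2 false true
windowOf bottom-under-odd         = window bottom      nothing            (just odd)         0 2 false true
windowOf odd-over-bottom          = window odd         (just bottom)      (just even)        1 2 true  true
windowOf odd-over-even            = window odd         (just even)        (just even)        1 2 true  true
windowOf even-between-odds        = window even        (just odd)         (just odd)         2 2 true  true
windowOf even-under-penultimate   = window even        (just odd)         (just penultimate) 2 2 true  true

successor : ∀ {n} → Fin n → Maybe (Fin n)
successor {n} i with suc (toℕ i) <? n
... | yes i+1<n = just (fromℕ< i+1<n)
... | no _      = nothing

predecessor : ∀ {n} → Fin n → Maybe (Fin n)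
predecessor fzero    = nothing
predecessor (fsuc i) = just (inject₁ i)

directions : List Direction
directions = east ∷ west ∷ north ∷ south ∷ up ∷ down ∷ []

-- Ranks are affine in the heights, so comparing them at the least heights, and comparing the
-- coefficients of the heights that may grow, settles the comparison throughout a window.
accepts : Bool → Bool → Cell → ℕ → ℕ → Cell → ℕ → ℕ → Bool
accepts gz gw seed                _  _  _ _ _ = true
accepts gz gw c′@(ranked _ e₁ e₂) z′ w′ c z w =
  (rankOf c′ z′ w′ <ᵇ rankOf c z w) ∧ (not gz ∨ (e₁ ≤ᵇ zCoeff c)) ∧ (not gw ∨ (e₂ ≤ᵇ wCoeff c))

supports : Window → Fin 3 → Fin 6 → Direction → Bool
supports (window L _ _ z w gz gw) x y east with successor x
... | just x′ = accepts gz gw (cell L x′ y) z w (cell L x y) z w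
... | nothing = false
supports (window L _ _ z w gz gw) x y west with predecessor x
... | just x′ = accepts gz gw (cell L x′ y) z w (cell L x y) z w
... | nothing = false
supports (window L _ _ z w gz gw) x y north with successor y
... | just y′ = accepts gz gw (cell L x y′) z w (cell L x y) z w
... | nothing = false
supports (window L _ _ z w gz gw) x y south with predecessor y
... | just y′ = accepts gz gw (cell L x y′) z w (cell L x y) z w
... | nothing = false
supports (window L _ (just L′) z (suc w) gz gw) x y up   = accepts gz gw (cell L′ x y) (suc z) w (cell L x y) z (suc w)
supports (window L (just L′) _ (suc z) w gz gw) x y down = accepts gz gw (cell L′ x y) z (suc w) (cell L x y) (suc z) w
supports _ _ _ up   = false
supports _ _ _ down = false

supportingDirections : Window → Fin 3 → Fin 6 → List Direction
supportingDirections W x y = filter (λ d → T? (supports W x y d)) directions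

settled : Window → Fin 3 → Fin 6 → Bool
settled W x y = isSeed (cell (Window.layer W) x y) ∨ (3 ≤ᵇ length (supportingDirections W x y))

valid : Window → Bool
valid W = all (λ x → all (settled W x) (allFin 6)) (allFin 3)

valid-windowOf : ∀ c → T (valid (windowOf c))
valid-windowOf top-over-penultimate     = _
valid-windowOf penultimate-over-bottom  = _
valid-windowOf penultimate-over-even    = _
valid-windowOf bottom-under-penultimate = _
valid-windowOf bottom-under-odd         = _
valid-windowOf odd-over-bottom          = _
valid-windowOf odd-over-even            = _
valid-windowOf even-between-odds        = _
valid-windowOf even-under-penultimate   = _

rankOf-shift : ∀ c z w dz dw → rankOf c (z + dz) (w + dw) ≡ rankOf c z w + (zCoeff c * dz + wCoeff c * dw)
rankOf-shift seed             z w dz dw = refl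
rankOf-shift (ranked e₀ e₁ e₂) z w dz dw = expand e₀ e₁ e₂ z w dz dw
  where
  expand : ∀ e₀ e₁ e₂ z w dz dw →
           e₀ + e₁ * (z + dz) + e₂ * (w + dw) ≡ e₀ + e₁ * z + e₂ * w + (e₁ * dz + e₂ * dw)
  expand = solve-∀

grow-coeff : ∀ g e f p → T (not g ∨ (e ≤ᵇ f)) → e * grow g p ≤ f * grow g p
grow-coeff true  e f p e≤f = *-monoˡ-≤ p (≤ᵇ⇒≤ e f e≤f)
grow-coeff false e f p _   = ≤-reflexive (trans (*-zeroʳ e) (sym (*-zeroʳ f)))

T-∧₃ : ∀ a b c → T (a ∧ b ∧ c) → T a × T b × T c
T-∧₃ true  true  true  _  = _ , _ , _
T-∧₃ true  true  false ()
T-∧₃ true  false _     ()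
T-∧₃ false _     _     ()

accepts-sound : ∀ gz gw c′ z′ w′ c z w → T (accepts gz gw c′ z′ w′ c z w) → ∀ p q →
  isSeed c′ ≡ true ⊎ rankOf c′ (z′ + grow gz p) (w′ + grow gw q) < rankOf c (z + grow gz p) (w + grow gw q)
accepts-sound gz gw seed                z′ w′ c z w _  p q = inj₁ refl
accepts-sound gz gw c′@(ranked _ e₁ e₂) z′ w′ c z w ok p q
  with T-∧₃ (rankOf c′ z′ w′ <ᵇ rankOf c z w) _ _ ok
... | base , zOk , wOk = inj₂ (begin-strict
  rankOf c′ (z′ + dz) (w′ + dw)                  ≡⟨ rankOf-shift c′ z′ w′ dz dw ⟩
  rankOf c′ z′ w′ + (e₁ * dz + e₂ * dw)          <⟨ +-mono-<-≤ base< (+-mono-≤ zStep wStep) ⟩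
  rankOf c z w + (zCoeff c * dz + wCoeff c * dw) ≡⟨ rankOf-shift c z w dz dw ⟨
  rankOf c (z + dz) (w + dw)                     ∎)
  where
  open ≤-Reasoning
  dz = grow gz p
  dw = grow gw q
  base< : rankOf c′ z′ w′ < rankOf c z w
  base< = <ᵇ⇒< (rankOf c′ z′ w′) (rankOf c z w) base
  zStep : e₁ * dz ≤ zCoeff c * dz
  zStep = grow-coeff gz e₁ (zCoeff c) p zOk
  wStep : e₂ * dw ≤ wCoeff c * dw
  wStep = grow-coeff gw e₂ (wCoeff c) q wOk

accepted : ∀ gz gw p q x′ y′ x y {z′ w′ z w L′ L zh′ wh′ zh wh} →
  layerOf zh′ wh′ ≡ L′ → zh′ ≡ z′ + grow gz p → wh′ ≡ w′ + grow gw q →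
  layerOf zh wh ≡ L → zh ≡ z + grow gz p → wh ≡ w + grow gw q →
  T (accepts gz gw (cell L′ x′ y′) z′ w′ (cell L x y) z w) →
  isSeed (cell (layerOf zh′ wh′) x′ y′) ≡ true
    ⊎ rankOf (cell (layerOf zh′ wh′) x′ y′) zh′ wh′ < rankOf (cell (layerOf zh wh) x y) zh wh
accepted gz gw p q x′ y′ x y refl refl refl refl refl refl ok = accepts-sound gz gw _ _ _ _ _ _ ok p q

successor-toℕ : ∀ {n} {i j : Fin n} → successor i ≡ just j → toℕ j ≡ suc (toℕ i)
successor-toℕ {n} {i} eq with suc (toℕ i) <? n
successor-toℕ refl | yes i+1<n = toℕ-fromℕ< i+1<n

predecessor-toℕ : ∀ {n} {i j : Fin n} → predecessor i ≡ just j → suc (toℕ j) ≡ toℕ i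
predecessor-toℕ {i = fsuc i} refl = cong suc (toℕ-inject₁ i)

three-distinct : ∀ {A : Set} {P : A → Set} (P? : Decidable P) {xs} →
                 Unique xs → 3 ≤ length (filter P? xs) → ThreeDistinct P
three-distinct {P = P} P? {xs} unique = pick (filter P? xs) (filter⁺ P? unique) (all-filter P? xs)
  where
  pick : ∀ ys → Unique ys → All P ys → 3 ≤ length ys → ThreeDistinct P
  pick (_ ∷ _ ∷ _ ∷ _) ((a≢b ∷ a≢c ∷ _) ∷ (b≢c ∷ _) ∷ _) (pa ∷ pb ∷ pc ∷ _) _ =
    distinct a≢b a≢c b≢c pa pb pc
  pick (_ ∷ _ ∷ []) _ _ (s≤s (s≤s ()))
  pick (_ ∷ [])     _ _ (s≤s ())
  pick []           _ _ ()

ThreeDistinct-map : ∀ {A : Set} {P Q : A → Set} → (∀ {a} → P a → Q a) → ThreeDistinct P → ThreeDistinct Q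
ThreeDistinct-map f (distinct ≢₁₂ ≢₁₃ ≢₂₃ p₁ p₂ p₃) =
  distinct ≢₁₂ ≢₁₃ ≢₂₃ (f p₁) (f p₂) (f p₃)

directions-unique : Unique directions
directions-unique =
  ((λ ()) ∷ (λ ()) ∷ (λ ()) ∷ (λ ()) ∷ (λ ()) ∷ []) ∷
  ((λ ()) ∷ (λ ()) ∷ (λ ()) ∷ (λ ()) ∷ []) ∷
  ((λ ()) ∷ (λ ()) ∷ (λ ()) ∷ []) ∷
  ((λ ()) ∷ (λ ()) ∷ []) ∷
  ((λ ()) ∷ []) ∷
  [] ∷
  []

module Construction (a : ℕ) where

  depth : Fin a → ℕ
  depth k = a ∸ suc (toℕ k)

  cellAt : Vertex 3 6 a → Cell
  cellAt (x , y , k) = cell (layerOf (toℕ k) (depth k)) x y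

  seeds : VSet 3 6 a
  seeds v = isSeed (cellAt v)

  rank : Vertex 3 6 a → ℕ
  rank v@(_ , _ , k) = rankOf (cellAt v) (toℕ k) (depth k)

  open RankedPercolation seeds rank

  step-up : ∀ (k : Fin a) {w} → depth k ≡ suc w → ∃[ k′ ] toℕ k′ ≡ suc (toℕ k) × depth k′ ≡ w
  step-up k {w} depth≡ = fromℕ< k+1<a , toℕ-fromℕ< k+1<a , depth-above
    where
    open ≡-Reasoning
    k+1<a : suc (toℕ k) < a
    k+1<a = m∸n≢0⇒n<m (λ depth≡0 → 0≢1+n (trans (sym depth≡0) depth≡))
    depth-above : depth (fromℕ< k+1<a) ≡ w
    depth-above = begin
      a ∸ suc (toℕ (fromℕ< k+1<a)) ≡⟨ cong (λ t → a ∸ suc t) (toℕ-fromℕ< k+1<a) ⟩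
      a ∸ suc (suc (toℕ k))        ≡⟨ pred[m∸n]≡m∸[1+n] a (suc (toℕ k)) ⟨
      pred (depth k)               ≡⟨ cong pred depth≡ ⟩
      w                            ∎

  step-down : ∀ (k : Fin a) {z} → toℕ k ≡ suc z → ∃[ k′ ] toℕ k′ ≡ z × depth k′ ≡ suc (depth k)
  step-down k {z} toℕ≡ = fromℕ< z<a , toℕ-fromℕ< z<a , depth-below
    where
    open ≡-Reasoning
    z<a : z < a
    z<a = <-trans (subst (z <_) (sym toℕ≡) (n<1+n z)) (toℕ<n k)
    depth-below : depth (fromℕ< z<a) ≡ suc (depth k)
    depth-below = begin
      a ∸ suc (toℕ (fromℕ< z<a))    ≡⟨ cong (λ t → a ∸ suc t) (toℕ-fromℕ< z<a) ⟩
      a ∸ suc z                     ≡⟨ cong (a ∸_) toℕ≡ ⟨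
      a ∸ toℕ k                     ≡⟨ cong (_∸ toℕ k) (m+[n∸m]≡n (toℕ<n k)) ⟨
      suc (toℕ k) + depth k ∸ toℕ k ≡⟨ cong (_∸ toℕ k) (+-suc (toℕ k) (depth k)) ⟨
      toℕ k + suc (depth k) ∸ toℕ k ≡⟨ m+n∸m≡n (toℕ k) (suc (depth k)) ⟩
      suc (depth k)                 ∎

  supports-sound : ∀ W {x y k} d → Occurs W (toℕ k) (depth k) → T (supports W x y d) → Supported (x , y , k) d
  supports-sound (window L _ _ z w gz gw) {x} {y} {k} east (occurs p q z≡ w≡ layer≡ _ _) ok
    with successor x in eq
  ... | just x′ = (x′ , y , k) , (successor-toℕ eq , refl , refl) ,
                  accepted gz gw p q x′ y x y layer≡ z≡ w≡ layer≡ z≡ w≡ ok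
  supports-sound (window L _ _ z w gz gw) {x} {y} {k} west (occurs p q z≡ w≡ layer≡ _ _) ok
    with predecessor x in eq
  ... | just x′ = (x′ , y , k) , (predecessor-toℕ eq , refl , refl) ,
                  accepted gz gw p q x′ y x y layer≡ z≡ w≡ layer≡ z≡ w≡ ok
  supports-sound (window L _ _ z w gz gw) {x} {y} {k} north (occurs p q z≡ w≡ layer≡ _ _) ok
    with successor y in eq
  ... | just y′ = (x , y′ , k) , (refl , successor-toℕ eq , refl) ,
                  accepted gz gw p q x y′ x y layer≡ z≡ w≡ layer≡ z≡ w≡ ok
  supports-sound (window L _ _ z w gz gw) {x} {y} {k} south (occurs p q z≡ w≡ layer≡ _ _) ok
    with predecessor y in eq
  ... | just y′ = (x , y′ , k) , (refl , predecessor-toℕ eq , refl) ,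
                  accepted gz gw p q x y′ x y layer≡ z≡ w≡ layer≡ z≡ w≡ ok
  supports-sound (window L _ (just L′) z (suc w) gz gw) {x} {y} {k} up (occurs p q z≡ w≡ layer≡ _ above≡) ok
    with step-up k w≡
  ... | k′ , toℕ≡ , depth≡ =
    (x , y , k′) , (refl , refl , toℕ≡) ,
    accepted gz gw p q x y x y
      (trans (cong₂ layerOf toℕ≡ depth≡) (above≡ w≡)) (trans toℕ≡ (cong suc z≡)) depth≡ layer≡ z≡ w≡ ok
  supports-sound (window L (just L′) _ (suc z) w gz gw) {x} {y} {k} down (occurs p q z≡ w≡ layer≡ below≡ _) ok
    with step-down k z≡
  ... | k′ , toℕ≡ , depth≡ =
    (x , y , k′) , (refl , refl , trans (cong suc toℕ≡) (sym z≡)) ,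
    accepted gz gw p q x y x y
      (trans (cong₂ layerOf toℕ≡ depth≡) (below≡ z≡)) toℕ≡ (trans depth≡ (cong suc w≡)) layer≡ z≡ w≡ ok

  certificate : ∀ c {x y k} → Occurs (windowOf c) (toℕ k) (depth k) → seeds (x , y , k) ≡ false →
                ThreeDistinct (Supported (x , y , k))
  certificate c {x} {y} {k} occ notSeed =
    ThreeDistinct-map (supports-sound W _ occ) (three-distinct (λ d → T? (supports W x y d)) directions-unique enough)
    where
    W = windowOf c
    row : T (all (settled W x) (allFin 6))
    row = All.lookup (all⁺ (λ x → all (settled W x) (allFin 6)) (allFin 3) (valid-windowOf c)) (∈-allFin x)
    settled-xy : T (settled W x y)
    settled-xy = All.lookup (all⁺ (settled W x) (allFin 6) row) (∈-allFin y)
    notSeed′ : isSeed (cell (Window.layer W) x y) ≡ false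
    notSeed′ = subst (λ L → isSeed (cell L x y) ≡ false) (Occurs.layer≡ occ) notSeed
    enough : 3 ≤ length (supportingDirections W x y)
    enough = ≤ᵇ⇒≤ 3 _ (subst (λ s → T (s ∨ (3 ≤ᵇ length (supportingDirections W x y)))) notSeed′ settled-xy)

-- Every height is seen through some window

parity : ∀ n → (middle n ≡ odd  × middle (suc n) ≡ even × n % 2 ≡ 0)
             ⊎ (middle n ≡ even × middle (suc n) ≡ odd  × n % 2 ≡ 1)
parity zero          = inj₁ (refl , refl , refl)
parity (suc zero)    = inj₂ (refl , refl , refl)
parity (suc (suc n)) = parity n

classify : ∀ z w → 2 ≤ z + w → z % 2 ≡ w % 2 → ∃[ c ] Occurs (windowOf c) z w
classify zero       zero       () _
classify zero       (suc zero) (s≤s ()) _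
classify (suc zero) zero       (s≤s ()) _
classify (suc (suc p)) zero _ _ =
  top-over-penultimate , occurs p 0 refl refl refl (λ { refl → refl }) tt
classify (suc zero) (suc zero) _ _ =
  penultimate-over-bottom , occurs 0 0 refl refl refl (λ { refl → refl }) (λ { refl → refl })
classify (suc (suc p)) (suc zero) _ same with parity p
... | inj₁ (_ , _ , p%2≡0) = ⊥-elim (0≢1+n (trans (sym p%2≡0) same))
... | inj₂ (middle-p , _ , _) =
  penultimate-over-even , occurs (suc p) 0 refl refl refl (λ { refl → middle-p }) (λ { refl → refl })
classify zero (suc (suc zero)) _ _ =
  bottom-under-penultimate , occurs 0 0 refl refl refl tt (λ { refl → refl })
classify zero (suc (suc (suc q))) _ _ =
  bottom-under-odd , occurs 0 (suc q) refl refl refl tt (λ { refl → refl })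
classify (suc zero) (suc (suc zero)) _ ()
classify (suc zero) (suc (suc (suc q))) _ _ =
  odd-over-bottom , occurs 0 (suc q) refl refl refl (λ { refl → refl }) (λ { refl → refl })
classify (suc (suc p)) (suc (suc q)) _ same with parity p | q
... | inj₁ (middle-p , middle-p+1 , _) | zero =
  even-under-penultimate , occurs p 0 refl refl middle-p+1 (λ { refl → middle-p }) (λ { refl → refl })
... | inj₁ (middle-p , middle-p+1 , _) | suc q′ =
  even-between-odds , occurs p (suc q′) refl refl middle-p+1 (λ { refl → middle-p }) (λ { refl → middle-p })
... | inj₂ (_ , _ , p%2≡1) | zero = ⊥-elim (0≢1+n (trans (sym same) p%2≡1))
... | inj₂ (middle-p , middle-p+1 , _) | suc q′ =
  odd-over-even , occurs (suc p) (suc q′) refl refl middle-p+1 (λ { refl → middle-p }) (λ { refl → middle-p })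

same-parity : ∀ z w → suc (z + w) % 2 ≡ 1 → z % 2 ≡ w % 2
same-parity zero          zero          _       = refl
same-parity zero          (suc zero)    ()
same-parity zero          (suc (suc w)) sum-odd = same-parity zero w sum-odd
same-parity (suc zero)    w             sum-odd = sym sum-odd
same-parity (suc (suc z)) w             sum-odd = same-parity z w sum-odd

module Percolation (a : ℕ) (3≤a : 3 ≤ a) (odd-a : a % 2 ≡ 1) where

  open Construction a
  open RankedPercolation seeds rank

  heights-sum : ∀ (k : Fin a) → suc (toℕ k + depth k) ≡ a
  heights-sum k = m+[n∸m]≡n (toℕ<n k)

  seeds-percolate : Percolates 3 seeds
  seeds-percolate = percolates-by-rank certified
    where
    certified : ∀ v → seeds v ≡ false → ThreeDistinct (Supported v)
    certified v@(_ , _ , k) notSeed with classify (toℕ k) (depth k) two same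
      where
      two : 2 ≤ toℕ k + depth k
      two = s≤s⁻¹ (subst (3 ≤_) (sym (heights-sum k)) 3≤a)
      same : toℕ k % 2 ≡ depth k % 2
      same = same-parity (toℕ k) (depth k) (subst (λ n → n % 2 ≡ 1) (sym (heights-sum k)) odd-a)
    ... | c , occ = certificate c occ notSeed

sumHeights : (ℕ → ℕ → ℕ) → ℕ → ℕ → ℕ
sumHeights g z zero    = g z zero
sumHeights g z (suc w) = g z (suc w) + sumHeights g (suc z) w

sumOver-heights : ∀ (g : ℕ → ℕ → ℕ) z n →
                  sumOver (λ k → g (z + toℕ k) (n ∸ toℕ k)) (allFin (suc n)) ≡ sumHeights g z n
sumOver-heights g z zero    = trans (+-identityʳ _) (cong (λ z′ → g z′ 0) (+-identityʳ z))
sumOver-heights g z (suc n) = begin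
  sumOver (λ k → g (z + toℕ k) (suc n ∸ toℕ k)) (allFin (suc (suc n)))
    ≡⟨ sumOver-allFin-suc (suc n) (λ k → g (z + toℕ k) (suc n ∸ toℕ k)) ⟩
  g (z + 0) (suc n) + sumOver (λ k → g (z + suc (toℕ k)) (n ∸ toℕ k)) (allFin (suc n))
    ≡⟨ cong₂ _+_ (cong (λ z′ → g z′ (suc n)) (+-identityʳ z))
                 (sumOver-cong (λ k → cong (λ z′ → g z′ (n ∸ toℕ k)) (+-suc z (toℕ k))) (allFin (suc n))) ⟩
  g z (suc n) + sumOver (λ k → g (suc z + toℕ k) (n ∸ toℕ k)) (allFin (suc n))
    ≡⟨ cong (g z (suc n) +_) (sumOver-heights g (suc z) n) ⟩
  g z (suc n) + sumHeights g (suc z) n ∎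
  where open ≡-Reasoning

seedCount : Layer → ℕ
seedCount L = sumOver (λ x → count (λ y → isSeed (cell L x y)) (allFin 6)) (allFin 3)

seedCount-middle : ∀ n → seedCount (middle n) ≡ 3
seedCount-middle zero          = refl
seedCount-middle (suc zero)    = refl
seedCount-middle (suc (suc n)) = seedCount-middle n

sumHeights-seedCount : ∀ z w → sumHeights (λ z w → seedCount (layerOf z w)) (suc z) (suc w) ≡ 3 * w + 10
sumHeights-seedCount z zero    = refl
sumHeights-seedCount z (suc w) = begin
  seedCount (middle z) + sumHeights (λ z w → seedCount (layerOf z w)) (suc (suc z)) (suc w)
    ≡⟨ cong₂ _+_ (seedCount-middle z) (sumHeights-seedCount (suc z) w) ⟩
  3 + (3 * w + 10) ≡⟨ regroup w ⟩
  3 * suc w + 10   ∎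
  where
  open ≡-Reasoning
  regroup : ∀ w → 3 + (3 * w + 10) ≡ 3 * suc w + 10
  regroup = solve-∀

size-seeds : ∀ w → size (Construction.seeds (3 + w)) ≡ 3 * (3 + w) + 6
size-seeds w = begin
  size seeds
    ≡⟨ Grid.size≡count seeds ⟩
  count seeds (vertices 3 6 a)
    ≡⟨ sumOver-vertices (λ v → ind (seeds v)) ⟩
  sumOver³ (λ x y k → ind (seeds (x , y , k))) (allFin 3) (allFin 6) (allFin a)
    ≡⟨ sumOver³-rotate (λ x y k → ind (seeds (x , y , k))) (allFin 3) (allFin 6) (allFin a) ⟩
  sumOver (λ k → seedCount (layerOf (toℕ k) (depth k))) (allFin a)
    ≡⟨ sumOver-heights (λ z w → seedCount (layerOf z w)) 0 (2 + w) ⟩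
  5 + sumHeights (λ z w → seedCount (layerOf z w)) 1 (suc w)
    ≡⟨ cong (5 +_) (sumHeights-seedCount 0 w) ⟩
  5 + (3 * w + 10)
    ≡⟨ regroup w ⟩
  3 * (3 + w) + 6 ∎
  where
  open ≡-Reasoning
  a = 3 + w
  open Construction a
  regroup : ∀ w → 5 + (3 * w + 10) ≡ 3 * (3 + w) + 6
  regroup = solve-∀

percolating⇒3a+6≤size : ∀ m (A : VSet 3 6 (suc m)) → Percolates 3 A → 3 * suc m + 6 ≤ size A
percolating⇒3a+6≤size m A percolates = *-cancelˡ-≤ 6 (+-cancelʳ-≤ D (6 * (3 * a + 6)) (6 * size A) (begin
  6 * (3 * a + 6) + D            ≡⟨ arithmetic m ⟩
  2 * 3 * (3 * (6 * a))          ≡⟨ cong (2 * 3 *_) (length-vertices 3 6 a) ⟨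
  2 * 3 * length (vertices 3 6 a) ≤⟨ Grid.percolating-lowerBound 3 A percolates ⟩
  2 * 3 * size A + Grid.degreeSum {3} {6} {a} ≡⟨ cong (2 * 3 * size A +_) (degreeSum-grid 3 6 a) ⟩
  6 * size A + D                 ∎))
  where
  open ≤-Reasoning
  a = suc m
  D = 2 * (2 * (6 * a) + 3 * (5 * a) + 3 * (6 * m))
  arithmetic : ∀ m → 6 * (3 * suc m + 6) + 2 * (2 * (6 * suc m) + 3 * (5 * suc m) + 3 * (6 * m)) ≡ 2 * 3 * (3 * (6 * suc m))
  arithmetic = solve-∀

σ₂-3×6 : ∀ a → σ₂ 3 6 a ≡ (3 * a + 6) * 3
σ₂-3×6 = expand
  where
  expand : ∀ a → 3 * 6 + 3 * a + 6 * a ≡ (3 * a + 6) * 3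
  expand = solve-∀

proposition5p11 : (a₃ : ℕ) → 3 ≤ a₃ → a₃ % 2 ≡ 1 → Perfect 3 6 a₃
proposition5p11 a₃@(suc (suc (suc w))) 3≤a₃@(s≤s (s≤s (s≤s _))) a₃-odd =
  trans (cong (_% 3) (σ₂-3×6 a₃)) (m*n%n≡0 (3 * a₃ + 6) 3) ,
  (seeds , Percolation.seeds-percolate a₃ 3≤a₃ a₃-odd , trans (size-seeds w) (sym m≡)) ,
  (λ A percolates → subst (_≤ size A) (sym m≡) (percolating⇒3a+6≤size (2 + w) A percolates))
  where
  open Construction a₃
  m≡ : σ₂ 3 6 a₃ / 3 ≡ 3 * a₃ + 6
  m≡ = trans (cong (_/ 3) (σ₂-3×6 a₃)) (m*n/n≡m (3 * a₃ + 6) 3)
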